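{- For every integer $n\geq 1$, the graph $G(L(Q_n))$ has a Hamiltonian cycle, where $Q_n$ denotes the $n$-dimensional hypercube.
   Context: The $n$-dimensional hypercube $Q_n$ is the convex hull of $\{0,1\}^n$. For a polytope $P$, its face lattice $L(P)$ is the set of all faces of $P$, including the empty face $\emptyset$ (of dimension $-1$) and $P$ itself, ordered by inclusion. The cover graph $G(L(P))$ has the faces of $P$ as vertices, and an edge between faces $F\subset F'$ whenever $\dim F'=\dim F+1$. (Equivalently for $Q_n$: the nonempty faces are encoded by strings in $\{0,1,-\}^n$, the face being the set of $0/1$-vectors obtained by replacing each $-$ by $0$ or $1$; the edges of $G(L(Q_n))$ join strings differing in replacing a single $0$ or $1$ by $-$, plus the edges between $\emptyset$ and every string in $\{0,1\}^n$.) -}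

module Defs where

open import Data.Nat using (ℕ; zero; suc; _≤_)
open import Data.Vec using (Vec; []; _∷_)
open import Data.Maybe using (Maybe; just; nothing)
open import Data.List using (List; []; _∷_; length)
open import Data.List.Relation.Unary.Linked using (Linked)
open import Data.List.Relation.Unary.Unique.Propositional using (Unique)
open import Data.List.Membership.Propositional using (_∈_)
open import Data.Product using (_×_)

-- Symbols encoding nonempty faces of Q_n: strings in {0,1,-}^n.
data Sym : Set where
  s0 s1 s- : Sym

-- Faces of Q_n (vertices of the face lattice L(Q_n)):
-- nothing = the empty face, just v = the nonempty face encoded by v.
Face : ℕ → Set
Face n = Maybe (Vec Sym n)

data SymUp : Sym → Sym → Set where
  up0 : SymUp s0 s-
  up1 : SymUp s1 s-

data Covers : {n : ℕ} → Vec Sym n → Vec Sym n → Set where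
  here  : ∀ {n a b} {v : Vec Sym n} → SymUp a b → Covers (a ∷ v) (b ∷ v)
  there : ∀ {n a} {v w : Vec Sym n} → Covers v w → Covers (a ∷ v) (a ∷ w)

data Bit : Sym → Set where
  b0 : Bit s0
  b1 : Bit s1

data IsVertex : {n : ℕ} → Vec Sym n → Set where
  []  : IsVertex []
  _∷_ : ∀ {n a} {v : Vec Sym n} → Bit a → IsVertex v → IsVertex (a ∷ v)

data Adj {n : ℕ} : Face n → Face n → Set where
  up      : ∀ {v w} → Covers v w → Adj (just v) (just w)
  down    : ∀ {v w} → Covers w v → Adj (just v) (just w)
  emptyUp   : ∀ {v} → IsVertex v → Adj nothing (just v)
  emptyDown : ∀ {v} → IsVertex v → Adj (just v) nothing

data LastAdj {n : ℕ} (x : Face n) : List (Face n) → Set where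
  single : ∀ {y} → Adj y x → LastAdj x (y ∷ [])
  cons   : ∀ {y z zs} → LastAdj x (z ∷ zs) → LastAdj x (y ∷ z ∷ zs)

record HamiltonianCycle (n : ℕ) : Set where
  field
    first     : Face n
    rest      : List (Face n)
    long      : 3 ≤ length (first ∷ rest)
    distinct  : Unique (first ∷ rest)
    spanning  : (x : Face n) → x ∈ (first ∷ rest)
    path      : Linked Adj (first ∷ rest)
    closing   : LastAdj first (first ∷ rest)

module Submission where

open import Defs
open import Data.Nat using (ℕ; zero; suc; _≤_; s≤s; z≤n)
open import Data.Vec using (Vec; []; _∷_; replicate)
open import Data.Vec.Properties using (∷-injectiveˡ; ∷-injectiveʳ)
open import Data.Maybe using (just; nothing)
open import Data.Maybe.Properties using (just-injective)
open import Data.List using (List; []; _∷_; _++_; [_]; map; length)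
open import Data.List.Relation.Unary.Linked using (Linked; [-]; _∷_)
open import Data.List.Relation.Unary.All using ([]; universal)
import Data.List.Relation.Unary.All.Properties as All
open import Data.List.Relation.Unary.Any using (here; there)
open import Data.List.Relation.Unary.Unique.Propositional using (Unique; []; _∷_)
import Data.List.Relation.Unary.Unique.Propositional.Properties as Unique
open import Data.List.Relation.Binary.Disjoint.Propositional using (Disjoint)
open import Data.List.Membership.Propositional using (_∈_)
open import Data.List.Membership.Propositional.Properties
  using (∈-++⁺ˡ; ∈-++⁺ʳ; ∈-++⁻; ∈-map⁺; ∈-map⁻)
open import Data.Product using (_,_)
open import Function using (_∘_)
open import Data.Empty using (⊥-elim)
open import Data.Sum using (_⊎_; inj₁; inj₂)
open import Relation.Binary.PropositionalEquality using (_≡_; refl; sym; _≢_)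

-- The nonempty faces of Q_(n+1) are listed by a path (snake) from 0…0 to
-- 1…1: first the faces 0w along such a path for Q_n, then the faces −w along
-- the path with the roles of 0 and 1 exchanged, from 1…1 to 0…0, then the
-- faces 1w along the first path again; the junctions are the covers
-- 0 1…1 ⊂ − 1…1 and 1 0…0 ⊂ − 0…0.  Both ends are vertices of Q_(n+1), hence
-- adjacent to the empty face, which closes the path into a Hamiltonian cycle.

data Path {A : Set} (R : A → A → Set) : A → A → List A → Set where
  ⟨_⟩  : ∀ a → Path R a a [ a ]
  _∷_  : ∀ {a b c xs} → R a b → Path R b c xs → Path R a c (a ∷ xs)

module _ {A : Set} {R : A → A → Set} where

  Path-++ : ∀ {a b c d xs ys} → Path R a b xs → R b c → Path R c d ys →
            Path R a d (xs ++ ys)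
  Path-++ ⟨ a ⟩    r q = r ∷ q
  Path-++ (s ∷ p) r q = s ∷ Path-++ p r q

  Path⇒Linked : ∀ {a b xs} → Path R a b xs → Linked R xs
  Path⇒Linked ⟨ a ⟩           = [-]
  Path⇒Linked (r ∷ ⟨ b ⟩)     = r ∷ [-]
  Path⇒Linked (r ∷ p@(_ ∷ _)) = r ∷ Path⇒Linked p

  Path-length : ∀ {a b xs} → a ≢ b → Path R a b xs → 2 ≤ length xs
  Path-length a≢b ⟨ a ⟩ = ⊥-elim (a≢b refl)
  Path-length a≢b (r ∷ ⟨ b ⟩) = s≤s (s≤s z≤n)
  Path-length a≢b (r ∷ (s ∷ p)) = s≤s (s≤s z≤n)

Path-map : ∀ {A B : Set} {R : A → A → Set} {S : B → B → Set} (f : A → B) →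
           (∀ {x y} → R x y → S (f x) (f y)) →
           ∀ {a b xs} → Path R a b xs → Path S (f a) (f b) (map f xs)
Path-map f g ⟨ a ⟩   = ⟨ f a ⟩
Path-map f g (r ∷ p) = g r ∷ Path-map f g p

Path⇒LastAdj : ∀ {n} {a b x : Face n} {xs} → Path Adj a b xs → Adj b x → LastAdj x xs
Path⇒LastAdj ⟨ a ⟩   r = single r
Path⇒LastAdj (s ∷ ⟨ b ⟩)     r = cons (single r)
Path⇒LastAdj (s ∷ p@(_ ∷ _)) r = cons (Path⇒LastAdj p r)

module _ {n : ℕ} where

  Disjoint-++⁺ʳ : {xs : List (Vec Sym n)} (ys : List (Vec Sym n)) {zs : List (Vec Sym n)} →
                  Disjoint xs ys → Disjoint xs zs → Disjoint xs (ys ++ zs)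
  Disjoint-++⁺ʳ ys xs#ys xs#zs (v∈xs , v∈ys++zs) with ∈-++⁻ ys v∈ys++zs
  ... | inj₁ v∈ys = xs#ys (v∈xs , v∈ys)
  ... | inj₂ v∈zs = xs#zs (v∈xs , v∈zs)

  map-∷-disjoint : ∀ {a c} {xs ys : List (Vec Sym n)} →
                   a ≢ c → Disjoint (map (a ∷_) xs) (map (c ∷_) ys)
  map-∷-disjoint {a} {c} a≢c (v∈axs , v∈cys) with ∈-map⁻ (a ∷_) v∈axs | ∈-map⁻ (c ∷_) v∈cys
  ... | _ , _ , refl | _ , _ , eq = a≢c (∷-injectiveˡ eq)

  map-∷-unique : ∀ {a} {xs : List (Vec Sym n)} → Unique xs → Unique (map (a ∷_) xs)
  map-∷-unique = Unique.map⁺ ∷-injectiveʳ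

data Opposite : Sym → Sym → Set where
  opposite₀₁ : Opposite s0 s1
  opposite₁₀ : Opposite s1 s0

module _ {a b : Sym} where

  Opposite-sym : Opposite a b → Opposite b a
  Opposite-sym opposite₀₁ = opposite₁₀
  Opposite-sym opposite₁₀ = opposite₀₁

  Opposite⇒SymUp : Opposite a b → SymUp a s-
  Opposite⇒SymUp opposite₀₁ = up0
  Opposite⇒SymUp opposite₁₀ = up1

  Opposite⇒≢s- : Opposite a b → a ≢ s-
  Opposite⇒≢s- opposite₀₁ ()
  Opposite⇒≢s- opposite₁₀ ()

  Opposite⇒≢ : Opposite a b → a ≢ b
  Opposite⇒≢ opposite₀₁ ()
  Opposite⇒≢ opposite₁₀ ()

  Opposite-cover : Opposite a b → (c : Sym) → c ≡ a ⊎ c ≡ s- ⊎ c ≡ b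
  Opposite-cover opposite₀₁ s0 = inj₁ refl
  Opposite-cover opposite₀₁ s- = inj₂ (inj₁ refl)
  Opposite-cover opposite₀₁ s1 = inj₂ (inj₂ refl)
  Opposite-cover opposite₁₀ s1 = inj₁ refl
  Opposite-cover opposite₁₀ s- = inj₂ (inj₁ refl)
  Opposite-cover opposite₁₀ s0 = inj₂ (inj₂ refl)

replicate-IsVertex : ∀ {a} → Bit a → (n : ℕ) → IsVertex (replicate n a)
replicate-IsVertex bit zero    = []
replicate-IsVertex bit (suc n) = bit ∷ replicate-IsVertex bit n

_~_ : ∀ {n} → Vec Sym n → Vec Sym n → Set
v ~ w = Adj (just v) (just w)

~-∷ : ∀ {n} (s : Sym) {v w : Vec Sym n} → v ~ w → (s ∷ v) ~ (s ∷ w)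
~-∷ s (up c)   = up (there c)
~-∷ s (down c) = down (there c)

snake : Sym → Sym → (n : ℕ) → List (Vec Sym n)
snake a b zero    = [ [] ]
snake a b (suc n) =
  map (a ∷_) (snake a b n) ++ map (s- ∷_) (snake b a n) ++ map (b ∷_) (snake a b n)

snake-path : ∀ {a b} → Opposite a b → (n : ℕ) →
             Path _~_ (replicate n a) (replicate n b) (snake a b n)
snake-path o zero    = ⟨ [] ⟩
snake-path {a} {b} o (suc n) =
  Path-++ (Path-map (a ∷_) (~-∷ a) (snake-path o n))
          (up (here (Opposite⇒SymUp o)))
          (Path-++ (Path-map (s- ∷_) (~-∷ s-) (snake-path (Opposite-sym o) n))
                   (down (here (Opposite⇒SymUp (Opposite-sym o))))
                   (Path-map (b ∷_) (~-∷ b) (snake-path o n)))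

snake-complete : ∀ {a b} → Opposite a b → ∀ {n} (v : Vec Sym n) → v ∈ snake a b n
snake-complete o [] = here refl
snake-complete {a} {b} o {suc n} (c ∷ v) with Opposite-cover o c
... | inj₁ refl = ∈-++⁺ˡ (∈-map⁺ (c ∷_) (snake-complete o v))
... | inj₂ (inj₁ refl) = ∈-++⁺ʳ (map (a ∷_) (snake a b n))
    (∈-++⁺ˡ (∈-map⁺ (s- ∷_) (snake-complete (Opposite-sym o) v)))
... | inj₂ (inj₂ refl) = ∈-++⁺ʳ (map (a ∷_) (snake a b n))
    (∈-++⁺ʳ (map (s- ∷_) (snake b a n)) (∈-map⁺ (c ∷_) (snake-complete o v)))

snake-unique : ∀ {a b} → Opposite a b → (n : ℕ) → Unique (snake a b n)
snake-unique o zero    = [] ∷ []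
snake-unique {a} {b} o (suc n) =
  Unique.++⁺ (map-∷-unique (snake-unique o n))
    (Unique.++⁺ (map-∷-unique (snake-unique (Opposite-sym o) n))
                (map-∷-unique (snake-unique o n))
                (map-∷-disjoint (Opposite⇒≢s- (Opposite-sym o) ∘ sym)))
    (Disjoint-++⁺ʳ (map (s- ∷_) (snake b a n))
                   (map-∷-disjoint (Opposite⇒≢s- o))
                   (map-∷-disjoint (Opposite⇒≢ o)))

theorem5 : (n : ℕ) → 1 ≤ n → HamiltonianCycle n
theorem5 (suc m) _ = record
  { first    = nothing
  ; rest     = map just faces
  ; long     = s≤s (Path-length (ends-differ ∘ just-injective) face-path)
  ; distinct = All.map⁺ (universal (λ _ ()) faces)
               ∷ Unique.map⁺ just-injective (snake-unique opposite₀₁ n)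
  ; spanning = λ { nothing  → here refl
                 ; (just v) → there (∈-map⁺ just (snake-complete opposite₀₁ v)) }
  ; path     = Path⇒Linked cycle
  ; closing  = Path⇒LastAdj cycle (emptyDown (replicate-IsVertex b1 n))
  }
  where
  n = suc m
  faces = snake s0 s1 n
  face-path : Path Adj (just (replicate n s0)) (just (replicate n s1)) (map just faces)
  face-path = Path-map just (λ r → r) (snake-path opposite₀₁ n)
  cycle : Path Adj nothing (just (replicate n s1)) (nothing ∷ map just faces)
  cycle = emptyUp (replicate-IsVertex b0 n) ∷ face-path
  ends-differ : replicate n s0 ≢ replicate n s1
  ends-differ ()
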